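{- Let $N,n$ be integers with $n\ge1$ and $N-2n+2\ge1$, and let $\lambda=(N,N-2,\dots,N-2n+2)$. Then \[ R(\lambda)=\binom{N+1}{n}. \]
   Context: For a strict partition $\lambda$, its shifted Young diagram is $\{(i,j):1\le i\le\ell(\lambda),\ i\le j\le\lambda_i+i-1\}$. $R(\lambda)$ is the number of shifted Young diagrams of strict partitions $\mu$ (including the empty one) contained in the shifted diagram of $\lambda$. -}

module Defs where

open import Data.Nat using (ℕ; zero; suc; _+_; _*_; _∸_; _<_; _>_; _≟_)
open import Data.Nat.Properties using (<-cmp)
import Data.Nat.Properties as ℕP
open import Data.Product using (_×_; _,_; Σ)
open import Data.Product.Properties using (≡-dec)
open import Data.List using (List; []; _∷_; _++_; map; upTo)
open import Data.List.Relation.Unary.All using (All; all?)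
open import Data.List.Relation.Unary.Linked using (Linked)
open import Data.List.Relation.Unary.Linked.Properties using ()
import Data.List.Relation.Unary.Linked as Lk
open import Data.List.Membership.DecPropositional (≡-dec _≟_ _≟_) using (_∈_; _∈?_)
open import Relation.Nullary using (Dec)
open import Relation.Nullary.Decidable using (True; _×-dec_)

IsStrict : List ℕ → Set
IsStrict μ = All (0 <_) μ × Linked _>_ μ

isStrict? : (μ : List ℕ) → Dec (IsStrict μ)
isStrict? μ = all? (λ x → 0 ℕP.<? x) μ ×-dec Lk.linked? (λ x y → y ℕP.<? x) μ

rowCells : ℕ → ℕ → List (ℕ × ℕ)
rowCells i len = map (λ k → (i , i + k)) (upTo len)

cellsFrom : ℕ → List ℕ → List (ℕ × ℕ)
cellsFrom i []       = []
cellsFrom i (x ∷ xs) = rowCells i x ++ cellsFrom (suc i) xs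

-- The shifted Young diagram {(i,j) : 1 ≤ i ≤ ℓ(λ), i ≤ j ≤ λ_i + i - 1}.
shiftedDiagram : List ℕ → List (ℕ × ℕ)
shiftedDiagram λ′ = cellsFrom 1 λ′

_⊆ˢ_ : List ℕ → List ℕ → Set
μ ⊆ˢ λ′ = All (_∈ shiftedDiagram λ′) (shiftedDiagram μ)

_⊆ˢ?_ : (μ λ′ : List ℕ) → Dec (μ ⊆ˢ λ′)
μ ⊆ˢ? λ′ = all? (_∈? shiftedDiagram λ′) (shiftedDiagram μ)

-- The set whose cardinality is R(λ): strict partitions μ (including the
-- empty one) whose shifted diagram is contained in that of λ.
-- (Membership witnesses are given via `True` of the decision procedures,
-- so they are proof-irrelevant and the cardinality is well defined.)
SubShapes : List ℕ → Set
SubShapes λ′ = Σ (List ℕ) (λ μ → True (isStrict? μ) × True (μ ⊆ˢ? λ′))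

staircase : ℕ → ℕ → List ℕ
staircase N n = map (λ i → N ∸ 2 * i) (upTo n)

-- Write μ ≼ λ when μ has at most as many parts as λ, each at most the corresponding
-- part of λ; since row i of a shifted diagram occupies columns i, …, i + λᵢ − 1, for
-- partitions with positive parts this is exactly containment of shifted diagrams. Let
-- Q(N, n) be the set of strict μ ≼ (N, N − 2, …, N − 2n + 2). Lowering every part of a
-- strict partition by one and deleting the resulting 0 (possible only for the last part)
-- is a bijection onto pairs (bit, strict partition). It maps Q(N + 1, m + 1) onto
-- Q(N, m) ⊎ Q(N, m + 1), the first summand receiving the partitions that had a part 1.
-- This is Pascal's rule, so |Q(N, n)| = C(N + 1, n) by induction on N. In the boundary
-- case N = 2m the last row of (N, …, N − 2m) is empty, so Q(N, m + 1) = Q(N, m), matching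
-- C(2m + 1, m + 1) = C(2m + 1, m).

module Submission where

open import Defs
open import Data.Nat using (ℕ; zero; suc; _+_; _*_; _∸_; _≤_; _<_; _>_; z≤n; s≤s; _≤?_)
open import Data.Nat.Properties
open import Data.Nat.Combinatorics using (_C_; nCk+nC[k+1]≡[n+1]C[k+1]; nCk≡nC[n∸k])
open import Data.Fin using (Fin)
open import Data.Fin.Properties using (+↔⊎)
open import Data.Bool using (Bool; true; false; if_then_else_)
open import Data.Bool.Properties using (T-irrelevant)
open import Data.Product using (Σ; ∃; _×_; _,_; proj₁; proj₂)
open import Data.Sum using (_⊎_; inj₁; inj₂)
open import Data.Sum.Function.Propositional using (_⊎-↔_)
open import Data.Empty using (⊥-elim)
open import Data.List using (List; []; _∷_; map; upTo; applyUpTo)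
open import Data.List.Properties using (map-upTo; map-applyUpTo; map-cong)
open import Data.List.Relation.Unary.All as All using (All; []; _∷_)
open import Data.List.Relation.Unary.All.Properties using (++⁺; ++⁻ʳ)
open import Data.List.Relation.Unary.Linked using ([]; [-]; _∷_)
open import Data.List.Relation.Binary.Prefix.Heterogeneous using (Prefix; []; _∷_)
import Data.List.Relation.Binary.Prefix.Heterogeneous.Properties as Prefix
open import Data.List.Relation.Binary.Subset.Propositional using (_⊆_)
open import Data.List.Membership.Propositional using (_∈_)
open import Data.List.Membership.Propositional.Properties
  using (∈-map⁺; ∈-map⁻; ∈-++⁻; ∈-++⁺ˡ; ∈-++⁺ʳ; ∈-upTo⁺; ∈-upTo⁻)
open import Relation.Binary.PropositionalEquality
open import Relation.Nullary using (¬_; yes; no; contradiction)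
open import Relation.Nullary.Decidable using (toWitness; fromWitness)
open import Function.Base using (_∘_)
open import Function.Bundles using (_↔_; mk↔ₛ′)
open import Function.Related.Propositional using (bijection)
import Function.Related.Propositional as Related

data Strict : List ℕ → Set where
  []  : Strict []
  [_] : ∀ {x} → 0 < x → Strict (x ∷ [])
  _∷_ : ∀ {x y xs} → x > y → Strict (y ∷ xs) → Strict (x ∷ y ∷ xs)

strict-irrelevant : ∀ {μ} (s s′ : Strict μ) → s ≡ s′
strict-irrelevant []        []          = refl
strict-irrelevant [ x>0 ]   [ x>0′ ]    = cong [_] (≤-irrelevant x>0 x>0′)
strict-irrelevant (x>y ∷ s) (x>y′ ∷ s′) = cong₂ _∷_ (≤-irrelevant x>y x>y′) (strict-irrelevant s s′)

strict-head-positive : ∀ {x xs} → Strict (x ∷ xs) → 0 < x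
strict-head-positive [ x>0 ]   = x>0
strict-head-positive (x>y ∷ s) = <-trans (strict-head-positive s) x>y

strict-tail : ∀ {x xs} → Strict (x ∷ xs) → Strict xs
strict-tail [ _ ]   = []
strict-tail (_ ∷ s) = s

¬strict-zero : ∀ {xs} → ¬ Strict (0 ∷ xs)
¬strict-zero s = <-irrefl refl (strict-head-positive s)

strict-one-last : ∀ {xs} → Strict (1 ∷ xs) → xs ≡ []
strict-one-last [ _ ]         = refl
strict-one-last (s≤s z≤n ∷ s) = ⊥-elim (¬strict-zero s)

IsStrict⇒Strict : ∀ {μ} → IsStrict μ → Strict μ
IsStrict⇒Strict {[]}        _                   = []
IsStrict⇒Strict {_ ∷ []}    (x>0 ∷ [] , _)      = [ x>0 ]
IsStrict⇒Strict {_ ∷ _ ∷ _} (_ ∷ ps , x>y ∷ lk) = x>y ∷ IsStrict⇒Strict (ps , lk)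

Strict⇒IsStrict : ∀ {μ} → Strict μ → IsStrict μ
Strict⇒IsStrict []          = [] , []
Strict⇒IsStrict [ x>0 ]     = x>0 ∷ [] , [-]
Strict⇒IsStrict s@(x>y ∷ s′) =
  let ps , lk = Strict⇒IsStrict s′ in strict-head-positive s ∷ ps , x>y ∷ lk

decrement : List ℕ → List ℕ
decrement []                 = []
decrement (zero ∷ xs)        = decrement xs
decrement (suc zero ∷ xs)    = decrement xs
decrement (suc (suc x) ∷ xs) = suc x ∷ decrement xs

hasPartOne : List ℕ → Bool
hasPartOne []                 = false
hasPartOne (zero ∷ xs)        = hasPartOne xs
hasPartOne (suc zero ∷ _)     = true
hasPartOne (suc (suc _) ∷ xs) = hasPartOne xs

increment : Bool → List ℕ → List ℕ
increment b []       = if b then 1 ∷ [] else []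
increment b (x ∷ xs) = suc x ∷ increment b xs

decrement-strict : ∀ {μ} → Strict μ → Strict (decrement μ)
decrement-strict []                                  = []
decrement-strict {zero ∷ _}                s         = ⊥-elim (¬strict-zero s)
decrement-strict {suc zero ∷ _}            s         rewrite strict-one-last s = []
decrement-strict {suc (suc _) ∷ []}        _         = [ s≤s z≤n ]
decrement-strict {suc (suc _) ∷ zero ∷ _}  (_ ∷ s)   = ⊥-elim (¬strict-zero s)
decrement-strict {suc (suc _) ∷ 1 ∷ _}     (_ ∷ s)   rewrite strict-one-last s = [ s≤s z≤n ]
decrement-strict {suc (suc _) ∷ suc (suc _) ∷ _} (x>y ∷ s) = ≤-pred x>y ∷ decrement-strict s

increment-strict : ∀ b {ν} → Strict ν → Strict (increment b ν)
increment-strict true  []        = [ s≤s z≤n ]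
increment-strict false []        = []
increment-strict true  [ x>0 ]   = s≤s x>0 ∷ [ s≤s z≤n ]
increment-strict false [ _ ]     = [ s≤s z≤n ]
increment-strict b     (x>y ∷ s) = s≤s x>y ∷ increment-strict b s

hasPartOne-increment : ∀ b {ν} → Strict ν → hasPartOne (increment b ν) ≡ b
hasPartOne-increment true  {[]}        _ = refl
hasPartOne-increment false {[]}        _ = refl
hasPartOne-increment b     {zero ∷ _}  s = ⊥-elim (¬strict-zero s)
hasPartOne-increment b     {suc _ ∷ _} s = hasPartOne-increment b (strict-tail s)

decrement-increment : ∀ b {ν} → Strict ν → decrement (increment b ν) ≡ ν
decrement-increment true  {[]}        _ = refl
decrement-increment false {[]}        _ = refl
decrement-increment b     {zero ∷ _}  s = ⊥-elim (¬strict-zero s)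
decrement-increment b     {suc x ∷ _} s = cong (suc x ∷_) (decrement-increment b (strict-tail s))

increment-decrement : ∀ {μ} → Strict μ → increment (hasPartOne μ) (decrement μ) ≡ μ
increment-decrement {[]}               _ = refl
increment-decrement {zero ∷ _}         s = ⊥-elim (¬strict-zero s)
increment-decrement {suc zero ∷ _}     s rewrite strict-one-last s = refl
increment-decrement {suc (suc x) ∷ _}  s = cong (suc (suc x) ∷_) (increment-decrement (strict-tail s))

stairs : ℕ → ℕ → List ℕ
stairs N zero    = []
stairs N (suc n) = N ∷ stairs (N ∸ 2) n

infix 4 _≼_

_≼_ : List ℕ → List ℕ → Set
_≼_ = Prefix _≤_

[1+m]+[1+m]≡2+[m+m] : ∀ m → suc m + suc m ≡ suc (suc (m + m))
[1+m]+[1+m]≡2+[m+m] m = cong suc (+-suc m m)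

[1+m]+[1+m]≤2+n⇒m+m≤n : ∀ {m n} → suc m + suc m ≤ suc (suc n) → m + m ≤ n
[1+m]+[1+m]≤2+n⇒m+m≤n {m} {n} = ≤-pred ∘ ≤-pred ∘ subst (_≤ suc (suc n)) ([1+m]+[1+m]≡2+[m+m] m)

[1+m]∸n≤1+[m∸n] : ∀ m n → suc m ∸ n ≤ suc (m ∸ n)
[1+m]∸n≤1+[m∸n] m n =
  m≤n+o⇒m∸n≤o (suc m) n (subst (suc m ≤_) (sym (+-suc n (m ∸ n))) (s≤s (m≤n+m∸n m n)))

≼-stairs-mono : ∀ {N N′} n {μ} → N ≤ N′ → μ ≼ stairs N n → μ ≼ stairs N′ n
≼-stairs-mono zero    _    []        = []
≼-stairs-mono (suc n) _    []        = []
≼-stairs-mono (suc n) N≤N′ (x≤N ∷ p) = ≤-trans x≤N N≤N′ ∷ ≼-stairs-mono n (∸-monoˡ-≤ 2 N≤N′) p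

≼-stairs-suc : ∀ {N} n {μ} → μ ≼ stairs N n → μ ≼ stairs N (suc n)
≼-stairs-suc zero    []        = []
≼-stairs-suc (suc n) []        = []
≼-stairs-suc (suc n) (x≤N ∷ p) = x≤N ∷ ≼-stairs-suc n p

strict-≼-stairs-zero : ∀ n {μ} → Strict μ → μ ≼ stairs 0 n → μ ≡ []
strict-≼-stairs-zero zero    _ []        = refl
strict-≼-stairs-zero (suc n) _ []        = refl
strict-≼-stairs-zero (suc n) s (z≤n ∷ _) = ⊥-elim (¬strict-zero s)

decrement-≼ : ∀ N n {μ} → Strict μ → μ ≼ stairs (suc N) n → decrement μ ≼ stairs N n
decrement-≼ N n       {[]}               _ _ = []
decrement-≼ N n       {zero ∷ _}         s _ = ⊥-elim (¬strict-zero s)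
decrement-≼ N n       {suc zero ∷ _}     s _ rewrite strict-one-last s = []
decrement-≼ N (suc n) {suc (suc _) ∷ _}  s (x≤N ∷ p) =
  ≤-pred x≤N ∷ decrement-≼ (N ∸ 2) n (strict-tail s) (≼-stairs-mono n ([1+m]∸n≤1+[m∸n] N 2) p)

decrement-≼-shorter : ∀ N n {μ} → Strict μ → hasPartOne μ ≡ true →
                      μ ≼ stairs (suc N) (suc n) → decrement μ ≼ stairs N n
decrement-≼-shorter N n       {zero ∷ _}             s _    _ = ⊥-elim (¬strict-zero s)
decrement-≼-shorter N n       {suc zero ∷ _}         s _    _ rewrite strict-one-last s = []
decrement-≼-shorter N zero    {suc (suc _) ∷ _ ∷ _}  _ _    (_ ∷ ())
decrement-≼-shorter N (suc n) {suc (suc _) ∷ _}      s has1 (x≤N ∷ p) =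
  ≤-pred x≤N ∷ decrement-≼-shorter (N ∸ 2) n (strict-tail s) has1
                 (≼-stairs-mono (suc n) ([1+m]∸n≤1+[m∸n] N 2) p)

increment-≼ : ∀ N n {ν} → Strict ν → ν ≼ stairs N n → increment false ν ≼ stairs (suc N) n
increment-≼ N             zero    _ []        = []
increment-≼ N             (suc n) _ []        = []
increment-≼ zero          (suc n) s (x≤0 ∷ _) = ⊥-elim (<⇒≱ (strict-head-positive s) x≤0)
increment-≼ 1             (suc n) s (x≤1 ∷ p)
  rewrite strict-≼-stairs-zero n (strict-tail s) p = s≤s x≤1 ∷ []
increment-≼ (suc (suc N)) (suc n) s (x≤N ∷ p) = s≤s x≤N ∷ increment-≼ N n (strict-tail s) p

increment-≼-new-row : ∀ N n {ν} → Strict ν → ν ≼ stairs N n → n + n ≤ N →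
                      increment true ν ≼ stairs (suc N) (suc n)
increment-≼-new-row N             zero          _ []      _        = s≤s z≤n ∷ []
increment-≼-new-row N             (suc n)       _ []      _        = s≤s z≤n ∷ []
increment-≼-new-row zero          (suc n)       _ (_ ∷ _) ()
increment-≼-new-row 1             (suc zero)    _ (_ ∷ _) (s≤s ())
increment-≼-new-row 1             (suc (suc n)) _ (_ ∷ _) (s≤s ())
increment-≼-new-row (suc (suc N)) (suc n)       s (x≤N ∷ p) 2n≤N =
  s≤s x≤N ∷ increment-≼-new-row N n (strict-tail s) p ([1+m]+[1+m]≤2+n⇒m+m≤n 2n≤N)

≼-stairs-drop-row : ∀ N n {μ} → N ≤ n + n → Strict μ → μ ≼ stairs N (suc n) → μ ≼ stairs N n
≼-stairs-drop-row N zero    N≤0  _ []        = []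
≼-stairs-drop-row N (suc n) _    _ []        = []
≼-stairs-drop-row N zero    N≤0  s (x≤N ∷ _) =
  ⊥-elim (<⇒≱ (strict-head-positive s) (≤-trans x≤N N≤0))
≼-stairs-drop-row N (suc n) N≤2n s (x≤N ∷ p) = x≤N ∷ ≼-stairs-drop-row (N ∸ 2) n N∸2≤2n (strict-tail s) p
  where
  N∸2≤2n : N ∸ 2 ≤ n + n
  N∸2≤2n = ∸-monoˡ-≤ 2 (subst (N ≤_) ([1+m]+[1+m]≡2+[m+m] n) N≤2n)

StrictFitting : List ℕ → Set
StrictFitting λ′ = Σ (List ℕ) (λ μ → Strict μ × μ ≼ λ′)

StrictFitting-≡ : ∀ {λ′ μ ν} {p : Strict μ × μ ≼ λ′} {q : Strict ν × ν ≼ λ′} →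
                  μ ≡ ν → _≡_ {A = StrictFitting λ′} (μ , p) (ν , q)
StrictFitting-≡ {μ = μ} {p = s , f} {q = s′ , f′} refl =
  cong₂ (λ s f → μ , s , f) (strict-irrelevant s s′) (Prefix.irrelevant ≤-irrelevant f f′)

StrictFitting-[]↔Fin1 : StrictFitting [] ↔ Fin 1
StrictFitting-[]↔Fin1 = mk↔ₛ′ (λ _ → Fin.zero) (λ _ → [] , [] , [])
  (λ { Fin.zero → refl ; (Fin.suc ()) })
  (λ { ([] , [] , []) → refl })

Σ-Bool↔⊎ : ∀ {ℓ} (P : Bool → Set ℓ) → Σ Bool P ↔ (P true ⊎ P false)
Σ-Bool↔⊎ P = mk↔ₛ′ to from
  (λ { (inj₁ _) → refl ; (inj₂ _) → refl })
  (λ { (true , _) → refl ; (false , _) → refl })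
  where
  to : Σ Bool P → P true ⊎ P false
  to (true  , p) = inj₁ p
  to (false , p) = inj₂ p
  from : P true ⊎ P false → Σ Bool P
  from (inj₁ p) = true , p
  from (inj₂ p) = false , p

StrictFitting-stairs-decrement↔ : ∀ M m → m + m ≤ M →
  StrictFitting (stairs (suc M) (suc m)) ↔ Σ Bool (λ b → StrictFitting (stairs M (if b then m else suc m)))
StrictFitting-stairs-decrement↔ M m 2m≤M = mk↔ₛ′ to from to∘from from∘to
  where
  Tagged : Set
  Tagged = Σ Bool (λ b → StrictFitting (stairs M (if b then m else suc m)))

  decrement-≼-tagged : ∀ {μ} → Strict μ → μ ≼ stairs (suc M) (suc m) →
                       decrement μ ≼ stairs M (if hasPartOne μ then m else suc m)
  decrement-≼-tagged {μ} s f with hasPartOne μ in eq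
  ... | true  = decrement-≼-shorter M m s eq f
  ... | false = decrement-≼ M (suc m) s f

  increment-≼-tagged : ∀ b {ν} → Strict ν → ν ≼ stairs M (if b then m else suc m) →
                       increment b ν ≼ stairs (suc M) (suc m)
  increment-≼-tagged true  s f = increment-≼-new-row M m s f 2m≤M
  increment-≼-tagged false s f = increment-≼ M (suc m) s f

  to : StrictFitting (stairs (suc M) (suc m)) → Tagged
  to (μ , s , f) = hasPartOne μ , decrement μ , decrement-strict s , decrement-≼-tagged s f

  from : Tagged → StrictFitting (stairs (suc M) (suc m))
  from (b , ν , s , f) = increment b ν , increment-strict b s , increment-≼-tagged b s f

  to∘from : ∀ y → to (from y) ≡ y
  to∘from (b , ν , s , f) = tagged-≡ (hasPartOne-increment b s) (decrement-increment b s)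
    where
    tagged-≡ : ∀ {b b′ μ ν p q} → b ≡ b′ → μ ≡ ν → _≡_ {A = Tagged} (b , μ , p) (b′ , ν , q)
    tagged-≡ {b} refl μ≡ν = cong (b ,_) (StrictFitting-≡ μ≡ν)

  from∘to : ∀ x → from (to x) ≡ x
  from∘to (μ , s , f) = StrictFitting-≡ (increment-decrement s)

StrictFitting-stairs-drop-row↔ : ∀ N n → N ≤ n + n →
  StrictFitting (stairs N (suc n)) ↔ StrictFitting (stairs N n)
StrictFitting-stairs-drop-row↔ N n N≤2n = mk↔ₛ′
  (λ { (μ , s , f) → μ , s , ≼-stairs-drop-row N n N≤2n s f })
  (λ { (μ , s , f) → μ , s , ≼-stairs-suc n f })
  (λ _ → StrictFitting-≡ refl)
  (λ _ → StrictFitting-≡ refl)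

[1+2m]Cm≡[1+2m]C[1+m] : ∀ m → suc (m + m) C m ≡ suc (m + m) C suc m
[1+2m]Cm≡[1+2m]C[1+m] m = trans (nCk≡nC[n∸k] (≤-trans (m≤m+n m m) (n≤1+n (m + m))))
                                (cong (suc (m + m) C_) (m+n∸n≡m (suc m) m))

StrictFitting-stairs↔binomial : ∀ N n → n + n ≤ suc N →
  StrictFitting (stairs N n) ↔ Fin (suc N C n)
StrictFitting-stairs↔binomial N       zero          _        = StrictFitting-[]↔Fin1
StrictFitting-stairs↔binomial zero    (suc zero)    (s≤s ())
StrictFitting-stairs↔binomial zero    (suc (suc n)) (s≤s ())
StrictFitting-stairs↔binomial (suc M) (suc m)       2m+2≤M+2 = begin
  StrictFitting (stairs (suc M) (suc m))
    ↔⟨ StrictFitting-stairs-decrement↔ M m 2m≤M ⟩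
  Σ Bool (λ b → StrictFitting (stairs M (if b then m else suc m)))
    ↔⟨ Σ-Bool↔⊎ _ ⟩
  (StrictFitting (stairs M m) ⊎ StrictFitting (stairs M (suc m)))
    ↔⟨ fewer-rows ⊎-↔ same-rows ⟩
  (Fin (suc M C m) ⊎ Fin (suc M C suc m))
    ↔⟨ +↔⊎ ⟨
  Fin (suc M C m + suc M C suc m)
    ≡⟨ cong Fin (nCk+nC[k+1]≡[n+1]C[k+1] (suc M) m) ⟩
  Fin (suc (suc M) C suc m)
    ∎
  where
  open Related.EquationalReasoning {k = bijection}

  2m≤M : m + m ≤ M
  2m≤M = [1+m]+[1+m]≤2+n⇒m+m≤n 2m+2≤M+2

  fewer-rows : StrictFitting (stairs M m) ↔ Fin (suc M C m)
  fewer-rows = StrictFitting-stairs↔binomial M m (≤-trans 2m≤M (n≤1+n M))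

  same-rows : StrictFitting (stairs M (suc m)) ↔ Fin (suc M C suc m)
  same-rows with suc m + suc m ≤? suc M
  ... | yes 2m+2≤M+1 = StrictFitting-stairs↔binomial M (suc m) 2m+2≤M+1
  ... | no  2m+2≰M+1 = begin
    StrictFitting (stairs M (suc m)) ↔⟨ StrictFitting-stairs-drop-row↔ M m M≤2m ⟩
    StrictFitting (stairs M m)       ↔⟨ fewer-rows ⟩
    Fin (suc M C m)                  ≡⟨ cong Fin [1+M]Cm≡[1+M]C[1+m] ⟩
    Fin (suc M C suc m)              ∎
    where
    M≤2m : M ≤ m + m
    M≤2m = ≤-pred (subst (suc M ≤_) (+-suc m m) (≤-pred (≰⇒> 2m+2≰M+1)))
    [1+M]Cm≡[1+M]C[1+m] : suc M C m ≡ suc M C suc m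
    [1+M]Cm≡[1+M]C[1+m] rewrite ≤-antisym M≤2m 2m≤M = [1+2m]Cm≡[1+2m]C[1+m] m

∈-rowCells⁻ : ∀ {i y c} → c ∈ rowCells i y → ∃ λ k → k < y × c ≡ (i , i + k)
∈-rowCells⁻ {i} c∈ with k , k∈ , refl ← ∈-map⁻ (λ k → (i , i + k)) c∈ = k , ∈-upTo⁻ k∈ , refl

rowCells-last : ∀ i x → (i , i + x) ∈ rowCells i (suc x)
rowCells-last i x = ∈-map⁺ (λ k → (i , i + k)) (∈-upTo⁺ (n<1+n x))

rowCells-mono : ∀ i {x y} → x ≤ y → rowCells i x ⊆ rowCells i y
rowCells-mono i x≤y c∈ with k , k<x , refl ← ∈-rowCells⁻ c∈ =
  ∈-map⁺ (λ k → (i , i + k)) (∈-upTo⁺ (≤-trans k<x x≤y))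

∈-cellsFrom⇒≤row : ∀ i λ′ {c} → c ∈ cellsFrom i λ′ → i ≤ proj₁ c
∈-cellsFrom⇒≤row i (y ∷ ys) c∈ with ∈-++⁻ (rowCells i y) c∈
... | inj₂ c∈rest = ≤-trans (n≤1+n i) (∈-cellsFrom⇒≤row (suc i) ys c∈rest)
... | inj₁ c∈row with _ , _ , refl ← ∈-rowCells⁻ c∈row = ≤-refl

∈-cellsFrom-row⇒< : ∀ {i x y ys} → (i , i + x) ∈ cellsFrom i (y ∷ ys) → x < y
∈-cellsFrom-row⇒< {i} {x} {y} {ys} c∈ with ∈-++⁻ (rowCells i y) c∈
... | inj₂ c∈rest = contradiction (∈-cellsFrom⇒≤row (suc i) ys c∈rest) (<-irrefl refl)
... | inj₁ c∈row with k , k<y , eq ← ∈-rowCells⁻ c∈row =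
  subst (_< y) (sym (+-cancelˡ-≡ i x k (cong proj₂ eq))) k<y

∈-cellsFrom-below : ∀ {i y ys c} → suc i ≤ proj₁ c → c ∈ cellsFrom i (y ∷ ys) → c ∈ cellsFrom (suc i) ys
∈-cellsFrom-below {i} {y} i<row c∈ with ∈-++⁻ (rowCells i y) c∈
... | inj₂ c∈rest = c∈rest
... | inj₁ c∈row with _ , _ , refl ← ∈-rowCells⁻ c∈row = contradiction i<row (<-irrefl refl)

≼⇒cellsFrom-⊆ : ∀ i {μ λ′} → μ ≼ λ′ → All (_∈ cellsFrom i λ′) (cellsFrom i μ)
≼⇒cellsFrom-⊆ i []                     = []
≼⇒cellsFrom-⊆ i {λ′ = y ∷ _} (x≤y ∷ p) =
  ++⁺ (All.tabulate (∈-++⁺ˡ ∘ rowCells-mono i x≤y))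
      (All.map (∈-++⁺ʳ (rowCells i y)) (≼⇒cellsFrom-⊆ (suc i) p))

cellsFrom-⊆⇒≼ : ∀ i {μ λ′} → All (0 <_) μ → All (_∈ cellsFrom i λ′) (cellsFrom i μ) → μ ≼ λ′
cellsFrom-⊆⇒≼ i {[]}         _         _   = []
cellsFrom-⊆⇒≼ i {zero ∷ _}   (() ∷ _)  _
cellsFrom-⊆⇒≼ i {suc x ∷ _}  {[]}      _ μ⊆λ with () ← All.lookup μ⊆λ (∈-++⁺ˡ (rowCells-last i x))
cellsFrom-⊆⇒≼ i {suc x ∷ xs} {y ∷ ys}  (_ ∷ pos) μ⊆λ =
  ∈-cellsFrom-row⇒< {i} {x} {y} {ys} (All.lookup μ⊆λ (∈-++⁺ˡ (rowCells-last i x))) ∷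
  cellsFrom-⊆⇒≼ (suc i) pos (All.tabulate lower-rows⊆)
  where
  lower-rows⊆ : cellsFrom (suc i) xs ⊆ cellsFrom (suc i) ys
  lower-rows⊆ c∈ = ∈-cellsFrom-below {i} {y} {ys} (∈-cellsFrom⇒≤row (suc i) xs c∈)
                                                 (All.lookup (++⁻ʳ (rowCells i (suc x)) μ⊆λ) c∈)

SubShapes↔StrictFitting : ∀ λ′ → SubShapes λ′ ↔ StrictFitting λ′
SubShapes↔StrictFitting λ′ = mk↔ₛ′ to from (λ _ → StrictFitting-≡ refl) from∘to
  where
  to : SubShapes λ′ → StrictFitting λ′
  to (μ , strict , μ⊆λ) =
    μ , IsStrict⇒Strict isStrict , cellsFrom-⊆⇒≼ 1 (proj₁ isStrict) (toWitness μ⊆λ)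
    where isStrict = toWitness strict

  from : StrictFitting λ′ → SubShapes λ′
  from (μ , s , f) = μ , fromWitness (Strict⇒IsStrict s) , fromWitness (≼⇒cellsFrom-⊆ 1 f)

  from∘to : ∀ x → from (to x) ≡ x
  from∘to (μ , _ , _) = cong₂ (λ p q → μ , p , q) (T-irrelevant _ _) (T-irrelevant _ _)

staircase-suc : ∀ N n → staircase N (suc n) ≡ N ∷ staircase (N ∸ 2) n
staircase-suc N n = cong (N ∷_) (begin
  map (λ i → N ∸ 2 * i) (applyUpTo suc n)     ≡⟨ map-applyUpTo suc (λ i → N ∸ 2 * i) n ⟩
  applyUpTo (λ i → N ∸ 2 * suc i) n           ≡⟨ map-upTo (λ i → N ∸ 2 * suc i) n ⟨
  map (λ i → N ∸ 2 * suc i) (upTo n)          ≡⟨ map-cong N∸2[1+i]≡N∸2∸2i (upTo n) ⟩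
  map (λ i → N ∸ 2 ∸ 2 * i) (upTo n)          ∎)
  where
  open ≡-Reasoning
  N∸2[1+i]≡N∸2∸2i : ∀ i → N ∸ 2 * suc i ≡ N ∸ 2 ∸ 2 * i
  N∸2[1+i]≡N∸2∸2i i = trans (cong (N ∸_) (*-suc 2 i)) (sym (∸-+-assoc N 2 (2 * i)))

staircase≡stairs : ∀ N n → staircase N n ≡ stairs N n
staircase≡stairs N zero    = refl
staircase≡stairs N (suc n) = trans (staircase-suc N n) (cong (N ∷_) (staircase≡stairs (N ∸ 2) n))

lemma5p2 : (N n : ℕ) → 1 ≤ n → 2 * n ≤ N + 1 →
    SubShapes (staircase N n) ↔ Fin ((N + 1) C n)
lemma5p2 N n _ 2n≤N+1 = begin
  SubShapes (staircase N n)     ↔⟨ SubShapes↔StrictFitting (staircase N n) ⟩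
  StrictFitting (staircase N n) ≡⟨ cong StrictFitting (staircase≡stairs N n) ⟩
  StrictFitting (stairs N n)    ↔⟨ StrictFitting-stairs↔binomial N n n+n≤1+N ⟩
  Fin (suc N C n)               ≡⟨ cong (λ k → Fin (k C n)) (+-comm 1 N) ⟩
  Fin ((N + 1) C n)             ∎
  where
  open Related.EquationalReasoning {k = bijection}
  n+n≤1+N : n + n ≤ suc N
  n+n≤1+N = subst₂ _≤_ (cong (n +_) (+-identityʳ n)) (+-comm N 1) 2n≤N+1
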